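{- Let $i=\sqrt{ -1}$ and let $\frac{r}{s}$ be an irreducible fraction. (1) $\mathcal{S}_{\frac rs}(i)=0$ if $s\equiv0\pmod4$; $\mathcal{S}_{\frac rs}(i)\in\{\pm(1+i),\pm(1-i)\}$ if $s\equiv2\pmod4$; $\mathcal{S}_{\frac rs}(i)\in\{\pm1,\pm i\}$ if $s$ is odd. Likewise $\mathcal{R}_{\frac rs}(i)=0$ if $r\equiv0\pmod4$; $\mathcal{R}_{\frac rs}(i)\in\{\pm(1+i),\pm(1-i)\}$ if $r\equiv2\pmod4$; $\mathcal{R}_{\frac rs}(i)\in\{\pm1,\pm i\}$ if $r$ is odd. (2) $s\equiv r\pmod 4$ if and only if $\mathcal{R}_{\frac rs}(i)=\mathcal{S}_{\frac rs}(i)$.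
   Context: For an integer $c$, $[c]_q=\frac{1-q^c}{1-q}$. Every rational $\alpha>1$ has a unique negative continued fraction expansion $\alpha=c_1-\cfrac{1}{c_2-\cfrac{1}{\ddots-\cfrac{1}{c_l}}}$ with integers $c_j\ge 2$. Put $M^-_q(c)=\begin{pmatrix}[c]_q & -q^{c-1}\\ 1 & 0\end{pmatrix}$ and define $\mathcal{R}_\alpha(q),\mathcal{S}_\alpha(q)$ by $\begin{pmatrix}\mathcal{R}_\alpha(q)\\ \mathcal{S}_\alpha(q)\end{pmatrix}=M^-_q(c_1)\cdots M^-_q(c_l)\begin{pmatrix}1\\0\end{pmatrix}$. For rational $\alpha\le 1$ they are defined recursively by $\mathcal{S}_\alpha(q)=\mathcal{S}_{\alpha+1}(q)$ and $\mathcal{R}_\alpha(q)=q^{ -1}(\mathcal{R}_{\alpha+1}(q)-\mathcal{S}_{\alpha+1}(q))$ (Laurent polynomials). For an irreducible fraction $\frac{r}{s}$ ($\gcd(r,s)=1$, $s>0$), $\mathcal{R}_{\frac rs}(1)=r$ and $\mathcal{S}_{\frac rs}(1)=s$. -}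

module Defs where

open import Data.Nat as ℕ using (ℕ; zero; suc)
open import Data.Integer as ℤ using (ℤ; +_; -[1+_])
open import Data.Product using (_×_; _,_; proj₁; proj₂)
open import Relation.Binary.PropositionalEquality using (_≡_)
open import Data.Sum using (_⊎_)
open import Relation.Nullary using (yes; no)

-- Gaussian integers ℤ[i] = { a + b i }.  Evaluating the (Laurent) polynomials
-- R_α(q), S_α(q) ∈ ℤ[q, q⁻¹] at q = i lands in ℤ[i].
record 𝔾 : Set where
  constructor _+_i
  field
    re : ℤ
    im : ℤ
open 𝔾 public

infixl 6 _⊕_ _⊖_
infixl 7 _⊗_

_⊕_ : 𝔾 → 𝔾 → 𝔾
(a + b i) ⊕ (c + d i) = (a ℤ.+ c) + (b ℤ.+ d) i

⊝_ : 𝔾 → 𝔾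
⊝ (a + b i) = (ℤ.- a) + (ℤ.- b) i

_⊖_ : 𝔾 → 𝔾 → 𝔾
x ⊖ y = x ⊕ (⊝ y)

_⊗_ : 𝔾 → 𝔾 → 𝔾
(a + b i) ⊗ (c + d i) = (a ℤ.* c ℤ.- b ℤ.* d) + (a ℤ.* d ℤ.+ b ℤ.* c) i

𝟘 𝟙 𝕚 : 𝔾
𝟘 = (+ 0) + (+ 0) i
𝟙 = (+ 1) + (+ 0) i
𝕚 = (+ 0) + (+ 1) i

_^_ : 𝔾 → ℕ → 𝔾
q ^ zero  = 𝟙
q ^ suc n = q ⊗ (q ^ n)

-- [c]_q = 1 + q + ... + q^(c-1) = (1 - q^c)/(1 - q)  (c ≥ 1 in all uses)
[_]_ : ℕ → 𝔾 → 𝔾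
[ zero ]  q = 𝟘
[ suc c ] q = 𝟙 ⊕ q ⊗ ([ c ] q)

-- Applying M^-_q(c) = ( [c]_q  -q^(c-1) ; 1  0 ) to a column vector (x , y).
M⁻ : 𝔾 → ℕ → 𝔾 × 𝔾 → 𝔾 × 𝔾
M⁻ q c (x , y) = ([ c ] q ⊗ x ⊖ (q ^ ℕ.pred c) ⊗ y , x)

-- (R_α(q), S_α(q)) for α = r/s > 1 (r > s ≥ 1, gcd(r,s) = 1), computed along
-- the negative continued fraction expansion α = c₁ - 1/α' :
--   * s = 1 : α = r = [[r]],  result M⁻(r)(1,0) = ([r]_q , 1);
--   * s ≥ 2 : c₁ = ⌈r/s⌉ = ⌊r/s⌋ + 1, α' = s / (c₁ s - r) > 1, and
--             (R_α, S_α) = M⁻(c₁) (R_α', S_α').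
-- The first argument is fuel; s strictly decreases, so fuel s+1 suffices
-- (the fuel-exhausted / s = 0 branches are never reached from qRatPos).
qRatPosAux : 𝔾 → ℕ → ℕ → ℕ → 𝔾 × 𝔾
qRatPosAux q zero    r s = (𝟘 , 𝟘)
qRatPosAux q (suc f) r zero = (𝟘 , 𝟘)
qRatPosAux q (suc f) r (suc zero) = ([ r ] q , 𝟙)
qRatPosAux q (suc f) r s@(suc (suc _)) =
  let c = suc (r ℕ./ s) in
  M⁻ q c (qRatPosAux q f s (c ℕ.* s ℕ.∸ r))

qRatPos : 𝔾 → ℕ → ℕ → 𝔾 × 𝔾
qRatPos q r s = qRatPosAux q (suc s) r s

-- (R_{r/s}(i), S_{r/s}(i)) for arbitrary r ∈ ℤ, s ≥ 1:
--   if r/s > 1 use qRatPos at q = i;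
--   otherwise S_α = S_{α+1},  R_α = q⁻¹ (R_{α+1} - S_{α+1}) with q⁻¹ = -i.
-- Fuel ∣r∣ + 3 suffices for s ≥ 1 (at most ∣r∣+2 shifts, then one base call).
qRatAtIAux : ℕ → ℤ → ℕ → 𝔾 × 𝔾
qRatAtIAux zero    r s = (𝟘 , 𝟘)
qRatAtIAux (suc f) r s with r
... | + n with s ℕ.<? n
...   | yes _ = qRatPos 𝕚 n s
...   | no  _ = step (qRatAtIAux f (r ℤ.+ + s) s)
  where
  step : 𝔾 × 𝔾 → 𝔾 × 𝔾
  step (R , S) = ((⊝ 𝕚) ⊗ (R ⊖ S) , S)
qRatAtIAux (suc f) r s | -[1+ n ] = step (qRatAtIAux f (r ℤ.+ + s) s)
  where
  step : 𝔾 × 𝔾 → 𝔾 × 𝔾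
  step (R , S) = ((⊝ 𝕚) ⊗ (R ⊖ S) , S)

qRatAtI : ℤ → ℕ → 𝔾 × 𝔾
qRatAtI r s = qRatAtIAux (ℤ.∣ r ∣ ℕ.+ 3) r s

ℛ[_/_]⟨i⟩ : ℤ → ℕ → 𝔾
ℛ[ r / s ]⟨i⟩ = proj₁ (qRatAtI r s)

𝒮[_/_]⟨i⟩ : ℤ → ℕ → 𝔾
𝒮[ r / s ]⟨i⟩ = proj₂ (qRatAtI r s)

IsUnit4 : 𝔾 → Set
IsUnit4 z = z ≡ 𝟙 ⊎ z ≡ ⊝ 𝟙 ⊎ z ≡ 𝕚 ⊎ z ≡ ⊝ 𝕚

IsOnePlusI : 𝔾 → Set
IsOnePlusI z = z ≡ 𝟙 ⊕ 𝕚 ⊎ z ≡ ⊝ (𝟙 ⊕ 𝕚) ⊎ z ≡ 𝟙 ⊖ 𝕚 ⊎ z ≡ ⊝ (𝟙 ⊖ 𝕚)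

module Submission where

-- At q = i we have i⁴ = 1 and [4]_i = 0, so M⁻_i(c) depends only on c mod 4
-- (for c ≥ 1).  Hence each step of the negative continued fraction, and each
-- shift (R, S) ↦ (−i(R − S), S) from α + 1 to α, maps a pair that is a fourth
-- root of unity times the entry of a fixed table indexed by (r mod 4, s mod 4)
-- to a pair of the same kind for the new numerator and denominator.  The start
-- value ([r]_i, 1) is of this kind, so (R_{r/s}(i), S_{r/s}(i)) is, up to a
-- unit, the table entry for (r mod 4, s mod 4), and both parts of the statement
-- are finite checks on the table.

open import Defs
open import Data.Nat as ℕ
  using (ℕ; zero; suc; _+_; _*_; _∸_; _%_; _/_; _<_; _≤_; _<?_; NonZero; s≤s)
open import Data.Nat.DivMod
  using (_mod_; m≡m%n+[m/n]*n; m%n<n; m%n%n≡m%n; %-distribˡ-+; %-distribˡ-*; [m+kn]%n≡m%n)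
import Data.Nat.Divisibility as ℕ∣
open import Data.Nat.Coprimality using (Coprime)
import Data.Nat.Properties as ℕP
import Data.Nat.Tactic.RingSolver as ℕSolver
open import Data.Integer as ℤ using (ℤ; +_; -[1+_]; _%ℕ_)
import Data.Integer.Properties as ℤP
open import Data.Integer.DivMod using (_/ℕ_; a≡a%ℕn+[a/ℕn]*n)
open import Data.Integer.Divisibility using (_∣_)
import Data.Integer.Divisibility.Signed as Signed
open import Data.Integer.Tactic.RingSolver using (solve-∀)
open import Data.Fin using (Fin; toℕ)
open import Data.Fin.Patterns using (0F; 1F; 2F; 3F)
open import Data.Fin.Properties using (all?; any?; toℕ-fromℕ<; fromℕ<-cong)
open import Data.Product using (_×_; _,_; Σ-syntax)
open import Data.Product.Properties using (≡-dec)
open import Data.Empty using (⊥-elim)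
open import Function using (_∘_)
open import Function.Bundles using (_⇔_; mk⇔)
open import Relation.Binary.Definitions using (DecidableEquality)
open import Relation.Binary.PropositionalEquality
  using (_≡_; _≢_; refl; sym; trans; cong; cong₂; subst; subst₂; module ≡-Reasoning)
open import Relation.Nullary using (Dec; yes; no; ¬_)
open import Relation.Nullary.Decidable using (from-yes; map′; _×-dec_; _⊎-dec_; _→-dec_; ¬?)

infix 4 _≟_
_≟_ : DecidableEquality 𝔾
(a + b i) ≟ (c + d i) with a ℤ.≟ c | b ℤ.≟ d
... | yes refl | yes refl = yes refl
... | no a≢c   | _        = no λ { refl → a≢c refl }
... | yes _    | no b≢d   = no λ { refl → b≢d refl }

isUnit4? : ∀ z → Dec (IsUnit4 z)
isUnit4? z = z ≟ _ ⊎-dec z ≟ _ ⊎-dec z ≟ _ ⊎-dec z ≟ _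

isOnePlusI? : ∀ z → Dec (IsOnePlusI z)
isOnePlusI? z = z ≟ _ ⊎-dec z ≟ _ ⊎-dec z ≟ _ ⊎-dec z ≟ _

infixr 7 _·_
_·_ : 𝔾 → 𝔾 × 𝔾 → 𝔾 × 𝔾
u · (x , y) = (u ⊗ x , u ⊗ y)

infix 4 _≃_ _≃?_
_≃_ : 𝔾 × 𝔾 → 𝔾 × 𝔾 → Set
p ≃ q = Σ[ k ∈ Fin 4 ] p ≡ 𝕚 ^ toℕ k · q

_≃?_ : ∀ p q → Dec (p ≃ q)
p ≃? q = any? λ k → ≡-dec _≟_ _≟_ p (𝕚 ^ toℕ k · q)

shift : 𝔾 × 𝔾 → 𝔾 × 𝔾
shift (R , S) = ((⊝ 𝕚) ⊗ (R ⊖ S) , S)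

toℕ-mod : ∀ n d .{{_ : NonZero d}} → toℕ (n mod d) ≡ n % d
toℕ-mod n d = toℕ-fromℕ< (m%n<n n d)

mod-cong : ∀ m n d .{{_ : NonZero d}} → m % d ≡ n % d → m mod d ≡ n mod d
mod-cong m n d eq = fromℕ<-cong _ _ eq _ _

%-toℕ-mod : ∀ n d .{{_ : NonZero d}} → n % d ≡ toℕ (n mod d) % d
%-toℕ-mod n d = trans (sym (m%n%n≡m%n n d)) (cong (_% d) (sym (toℕ-mod n d)))

%-+-cong : ∀ m m' n n' {d} .{{_ : NonZero d}} →
  m % d ≡ m' % d → n % d ≡ n' % d → (m + n) % d ≡ (m' + n') % d
%-+-cong m m' n n' {d} m≡m' n≡n' = begin
  (m + n) % d             ≡⟨ %-distribˡ-+ m n d ⟩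
  (m % d + n % d) % d     ≡⟨ cong₂ (λ a b → (a + b) % d) m≡m' n≡n' ⟩
  (m' % d + n' % d) % d   ≡⟨ %-distribˡ-+ m' n' d ⟨
  (m' + n') % d           ∎
  where open ≡-Reasoning

%-*-cong : ∀ m m' n n' {d} .{{_ : NonZero d}} →
  m % d ≡ m' % d → n % d ≡ n' % d → (m * n) % d ≡ (m' * n') % d
%-*-cong m m' n n' {d} m≡m' n≡n' = begin
  (m * n) % d             ≡⟨ %-distribˡ-* m n d ⟩
  (m % d * (n % d)) % d   ≡⟨ cong₂ (λ a b → (a * b) % d) m≡m' n≡n' ⟩
  (m' % d * (n' % d)) % d ≡⟨ %-distribˡ-* m' n' d ⟨
  (m' * n') % d           ∎
  where open ≡-Reasoning

-- The residue of r = c·s − s′ is that of c·s + 3·s′.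
ceiling-residue : ∀ r q s s' → r + s' ≡ suc q * s →
  r mod 4 ≡ (suc (toℕ (q mod 4)) * toℕ (s mod 4) + 3 * toℕ (s' mod 4)) mod 4
ceiling-residue r q s s' r+s'≡cs = mod-cong r (suc q̄ * s̄ + 3 * s̄') 4 (begin
  r % 4                  ≡⟨ [m+kn]%n≡m%n r s' 4 ⟨
  (r + s' * 4) % 4       ≡⟨ cong (_% 4) (trans (regroup r s') (cong (_+ 3 * s') r+s'≡cs)) ⟩
  (suc q * s + 3 * s') % 4
    ≡⟨ %-+-cong (suc q * s) (suc q̄ * s̄) (3 * s') (3 * s̄')
         (%-*-cong (suc q) (suc q̄) s s̄ (%-+-cong 1 1 q q̄ refl (%-toℕ-mod q 4)) (%-toℕ-mod s 4))
         (%-*-cong 3 3 s' s̄' refl (%-toℕ-mod s' 4)) ⟩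
  (suc q̄ * s̄ + 3 * s̄') % 4 ∎)
  where
  open ≡-Reasoning
  q̄ s̄ s̄' : ℕ
  q̄  = toℕ (q mod 4)
  s̄  = toℕ (s mod 4)
  s̄' = toℕ (s' mod 4)
  regroup : ∀ m n → m + n * 4 ≡ m + n + 3 * n
  regroup = ℕSolver.solve-∀

shift-residue : ∀ a s →
  (a + 3 * s) mod 4 ≡ (toℕ (a mod 4) + 3 * toℕ (s mod 4)) mod 4
shift-residue a s = mod-cong (a + 3 * s) (ā + 3 * s̄) 4
  (%-+-cong a ā (3 * s) (3 * s̄) (%-toℕ-mod a 4) (%-*-cong 3 3 s s̄ refl (%-toℕ-mod s 4)))
  where
  ā s̄ : ℕ
  ā = toℕ (a mod 4)
  s̄ = toℕ (s mod 4)

recurrence-periodic : ∀ {A : Set} d (f : ℕ → A) (step : A → A) →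
  (∀ n → f (suc n) ≡ step (f n)) → f d ≡ f 0 → ∀ n → f (d + n) ≡ f n
recurrence-periodic d f step rec fd≡f0 zero = trans (cong f (ℕP.+-identityʳ d)) fd≡f0
recurrence-periodic d f step rec fd≡f0 (suc n) = begin
  f (d + suc n)    ≡⟨ cong f (ℕP.+-suc d n) ⟩
  f (suc (d + n))  ≡⟨ rec (d + n) ⟩
  step (f (d + n)) ≡⟨ cong step (recurrence-periodic d f step rec fd≡f0 n) ⟩
  step (f n)       ≡⟨ rec n ⟨
  f (suc n)        ∎
  where open ≡-Reasoning

periodic⇒mod-invariant : ∀ {A : Set} d .{{_ : NonZero d}} (f : ℕ → A) →
  (∀ n → f (d + n) ≡ f n) → ∀ n → f n ≡ f (toℕ (n mod d))
periodic⇒mod-invariant d f period n = begin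
  f n                   ≡⟨ cong f (m≡m%n+[m/n]*n n d) ⟩
  f (n % d + n / d * d) ≡⟨ dropMultiple (n % d) (n / d) ⟩
  f (n % d)             ≡⟨ cong f (toℕ-mod n d) ⟨
  f (toℕ (n mod d))     ∎
  where
  open ≡-Reasoning
  dropMultiple : ∀ m k → f (m + k * d) ≡ f m
  dropMultiple m zero    = cong f (ℕP.+-identityʳ m)
  dropMultiple m (suc k) = begin
    f (m + (d + k * d)) ≡⟨ cong f (ℕP.+-comm m (d + k * d)) ⟩
    f (d + k * d + m)   ≡⟨ cong f (ℕP.+-assoc d (k * d) m) ⟩
    f (d + (k * d + m)) ≡⟨ period (k * d + m) ⟩
    f (k * d + m)       ≡⟨ cong f (ℕP.+-comm (k * d) m) ⟩
    f (m + k * d)       ≡⟨ dropMultiple m k ⟩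
    f m                 ∎

[]𝕚-mod4 : ∀ n → [ n ] 𝕚 ≡ [ toℕ (n mod 4) ] 𝕚
[]𝕚-mod4 = periodic⇒mod-invariant 4 ([_] 𝕚)
  (recurrence-periodic 4 ([_] 𝕚) (λ z → 𝟙 ⊕ 𝕚 ⊗ z) (λ _ → refl) refl)

^𝕚-mod4 : ∀ n → 𝕚 ^ n ≡ 𝕚 ^ toℕ (n mod 4)
^𝕚-mod4 = periodic⇒mod-invariant 4 (𝕚 ^_)
  (recurrence-periodic 4 (𝕚 ^_) (𝕚 ⊗_) (λ _ → refl) refl)

M⁻𝕚-mod4 : ∀ c p → M⁻ 𝕚 (suc c) p ≡ M⁻ 𝕚 (suc (toℕ (c mod 4))) p
M⁻𝕚-mod4 c (x , y) =
  cong₂ (λ B P → ((𝟙 ⊕ 𝕚 ⊗ B) ⊗ x ⊖ P ⊗ y , x)) ([]𝕚-mod4 c) (^𝕚-mod4 c)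

-- Up to a unit, the values at i of a fraction r/s with r ≡ a and s ≡ b (mod 4).
-- Both-even residues, which coprime r and s never have, are sent to (0, 0); this
-- keeps the table closed under the steps below.
residueTable : Fin 4 → Fin 4 → 𝔾 × 𝔾
residueTable 0F 1F = (𝟘 , 𝟙)
residueTable 0F 3F = (𝟘 , 𝟙)
residueTable 1F 0F = (𝟙 , 𝟘)
residueTable 1F 1F = (𝟙 , 𝟙)
residueTable 1F 2F = (𝟙 , 𝟙 ⊖ 𝕚)
residueTable 1F 3F = (𝟙 , ⊝ 𝕚)
residueTable 2F 1F = (𝟙 ⊕ 𝕚 , 𝟙)
residueTable 2F 3F = (𝟙 ⊕ 𝕚 , 𝟙)
residueTable 3F 0F = (𝟙 , 𝟘)
residueTable 3F 1F = (𝟙 , ⊝ 𝕚)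
residueTable 3F 2F = (𝟙 , 𝟙 ⊖ 𝕚)
residueTable 3F 3F = (𝟙 , 𝟙)
residueTable _  _  = (𝟘 , 𝟘)

residueTable-start : ∀ a → ([ toℕ a ] 𝕚 , 𝟙) ≃ residueTable a 1F
residueTable-start = from-yes (all? λ a → ([ toℕ a ] 𝕚 , 𝟙) ≃? residueTable a 1F)

residueTable-M⁻ : ∀ (j b b' k : Fin 4) →
  M⁻ 𝕚 (suc (toℕ j)) (𝕚 ^ toℕ k · residueTable b b')
    ≃ residueTable ((suc (toℕ j) * toℕ b + 3 * toℕ b') mod 4) b
residueTable-M⁻ = from-yes
  (all? λ (j : Fin 4) → all? λ (b : Fin 4) → all? λ (b' : Fin 4) → all? λ (k : Fin 4) →
    M⁻ 𝕚 (suc (toℕ j)) (𝕚 ^ toℕ k · residueTable b b')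
      ≃? residueTable ((suc (toℕ j) * toℕ b + 3 * toℕ b') mod 4) b)

residueTable-shift : ∀ (a b k : Fin 4) →
  shift (𝕚 ^ toℕ k · residueTable a b) ≃ residueTable ((toℕ a + 3 * toℕ b) mod 4) b
residueTable-shift = from-yes
  (all? λ (a : Fin 4) → all? λ (b : Fin 4) → all? λ (k : Fin 4) →
    shift (𝕚 ^ toℕ k · residueTable a b) ≃? residueTable ((toℕ a + 3 * toℕ b) mod 4) b)

normalForm : ℕ → ℕ → 𝔾 × 𝔾
normalForm r s = residueTable (r mod 4) (s mod 4)

normalForm-start : ∀ r → ([ r ] 𝕚 , 𝟙) ≃ normalForm r 1
normalForm-start r = subst (λ z → (z , 𝟙) ≃ normalForm r 1) (sym ([]𝕚-mod4 r))
  (residueTable-start (r mod 4))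

M⁻-normalForm : ∀ {p} r q s s' → r + s' ≡ suc q * s →
  p ≃ normalForm s s' → M⁻ 𝕚 (suc q) p ≃ normalForm r s
M⁻-normalForm r q s s' r+s'≡cs (k , refl) =
  subst₂ _≃_ (sym (M⁻𝕚-mod4 q _))
    (cong (λ a → residueTable a (s mod 4)) (sym (ceiling-residue r q s s' r+s'≡cs)))
    (residueTable-M⁻ (q mod 4) (s mod 4) (s' mod 4) k)

shift-normalForm : ∀ {p} a s → p ≃ normalForm a s → shift p ≃ normalForm (a + 3 * s) s
shift-normalForm a s (k , refl) =
  subst (λ a' → shift (𝕚 ^ toℕ k · normalForm a s) ≃ residueTable a' (s mod 4))
    (sym (shift-residue a s))
    (residueTable-shift (a mod 4) (s mod 4) k)

≤[1+m/n]*n : ∀ m n .{{_ : NonZero n}} → m ≤ suc (m / n) * n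
≤[1+m/n]*n m n = begin
  m                 ≡⟨ m≡m%n+[m/n]*n m n ⟩
  m % n + m / n * n ≤⟨ ℕP.+-monoˡ-≤ (m / n * n) (ℕP.<⇒≤ (m%n<n m n)) ⟩
  n + m / n * n     ∎
  where open ℕP.≤-Reasoning

[1+m/n]*n∸m≡n∸m%n : ∀ m n .{{_ : NonZero n}} → suc (m / n) * n ∸ m ≡ n ∸ m % n
[1+m/n]*n∸m≡n∸m%n m n = begin
  (n + m / n * n) ∸ m                   ≡⟨ cong ((n + m / n * n) ∸_) (m≡m%n+[m/n]*n m n) ⟩
  (n + m / n * n) ∸ (m % n + m / n * n) ≡⟨ cong₂ _∸_ (ℕP.+-comm n _) (ℕP.+-comm (m % n) _) ⟩
  (m / n * n + n) ∸ (m / n * n + m % n) ≡⟨ ℕP.[m+n]∸[m+o]≡n∸o (m / n * n) n (m % n) ⟩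
  n ∸ m % n                             ∎
  where open ≡-Reasoning

coprime⇒%≢0 : ∀ m n .{{_ : NonZero n}} → 1 < n → Coprime m n → m % n ≢ 0
coprime⇒%≢0 m n 1<n cop m%n≡0 = ℕP.>⇒≢ 1<n (cop (ℕ∣.m%n≡0⇒n∣m m n m%n≡0 , ℕ∣.∣-refl))

coprime-∸ : ∀ {m n} c → m ≤ c * n → Coprime m n → Coprime n (c * n ∸ m)
coprime-∸ {m} {n} c m≤cn cop {d} (d∣n , d∣cn∸m) = cop (d∣m , d∣n)
  where
  d∣m : d ℕ∣.∣ m
  d∣m = ℕ∣.∣m+n∣m⇒∣n (subst (d ℕ∣.∣_) (sym (ℕP.m∸n+n≡m m≤cn)) (ℕ∣.∣n⇒∣m*n c d∣n)) d∣cn∸m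

qRatPosAux-normalForm : ∀ f r s → 0 < s → s < f → Coprime r s →
  qRatPosAux 𝕚 f r s ≃ normalForm r s
qRatPosAux-normalForm zero    r s       _  ()        _
qRatPosAux-normalForm (suc f) r zero    () _         _
qRatPosAux-normalForm (suc f) r 1       _  _         _   = normalForm-start r
qRatPosAux-normalForm (suc f) r s@(suc (suc _)) _ (s≤s s≤f) cop =
  M⁻-normalForm r (r / s) s s' (ℕP.m+[n∸m]≡n r≤cs)
    (qRatPosAux-normalForm f s s' 0<s' (ℕP.<-≤-trans s'<s s≤f) (coprime-∸ (suc (r / s)) r≤cs cop))
  where
  s' : ℕ
  s' = suc (r / s) * s ∸ r
  r≤cs : r ≤ suc (r / s) * s
  r≤cs = ≤[1+m/n]*n r s
  0<r%s : 0 < r % s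
  0<r%s = ℕP.n≢0⇒n>0 (coprime⇒%≢0 r s (s≤s (s≤s ℕ.z≤n)) cop)
  0<s' : 0 < s'
  0<s' = subst (0 <_) (sym ([1+m/n]*n∸m≡n∸m%n r s)) (ℕP.m<n⇒0<n∸m (m%n<n r s))
  s'<s : s' < s
  s'<s = subst (_< s) (sym ([1+m/n]*n∸m≡n∸m%n r s)) (ℕP.∸-monoʳ-< 0<r%s (ℕP.<⇒≤ (m%n<n r s)))

infix 4 _≡[_]_ _≡?[_]_
record _≡[_]_ (x : ℤ) (d : ℕ) (y : ℤ) : Set where
  constructor congruent
  field divides : + d Signed.∣ x ℤ.- y

_≡?[_]_ : ∀ x d y → Dec (x ≡[ d ] y)
x ≡?[ d ] y = map′ congruent _≡[_]_.divides (+ d Signed.∣? x ℤ.- y)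

≡-mod-refl : ∀ x {d} → x ≡[ d ] x
≡-mod-refl x = congruent (Signed.divides (+ 0) (ℤP.+-inverseʳ x))

≡-mod-sym : ∀ {x y d} → x ≡[ d ] y → y ≡[ d ] x
≡-mod-sym {x} {y} (congruent d∣x-y) =
  congruent (subst (_ Signed.∣_) (negate x y) (Signed.∣m⇒∣-m d∣x-y))
  where
  negate : ∀ x y → ℤ.- (x ℤ.- y) ≡ y ℤ.- x
  negate = solve-∀

≡-mod-trans : ∀ {x y z d} → x ≡[ d ] y → y ≡[ d ] z → x ≡[ d ] z
≡-mod-trans {x} {y} {z} (congruent d∣x-y) (congruent d∣y-z) =
  congruent (subst (_ Signed.∣_) (ℤP.+-minus-telescope x y z) (Signed.∣m∣n⇒∣m+n d∣x-y d∣y-z))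

≡-mod-weaken : ∀ {e d x y} → e ℕ∣.∣ d → x ≡[ d ] y → x ≡[ e ] y
≡-mod-weaken {e} {d} e∣d (congruent d∣x-y) =
  congruent (Signed.∣-trans (Signed.∣ᵤ⇒∣ {+ e} {+ d} e∣d) d∣x-y)

≡-mod-%ℕ : ∀ x d .{{_ : NonZero d}} → x ≡[ d ] + (x %ℕ d)
≡-mod-%ℕ x d = congruent (Signed.divides (x /ℕ d) (begin
  x ℤ.- + (x %ℕ d)                                ≡⟨ cong (ℤ._- + (x %ℕ d)) (a≡a%ℕn+[a/ℕn]*n x d) ⟩
  + (x %ℕ d) ℤ.+ x /ℕ d ℤ.* + d ℤ.- + (x %ℕ d)    ≡⟨ cancel (+ (x %ℕ d)) (x /ℕ d ℤ.* + d) ⟩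
  x /ℕ d ℤ.* + d                                  ∎))
  where
  open ≡-Reasoning
  cancel : ∀ m n → m ℤ.+ n ℤ.- m ≡ n
  cancel = solve-∀

≡-mod-4⇒2 : ∀ {x y} → x ≡[ 4 ] y → x ≡[ 2 ] y
≡-mod-4⇒2 = ≡-mod-weaken (ℕ∣.divides 2 refl)

%ℕ⇒≡-mod : ∀ x d k .{{_ : NonZero d}} → x %ℕ d ≡ k → x ≡[ d ] + k
%ℕ⇒≡-mod x d k x%d≡k = subst (λ j → x ≡[ d ] + j) x%d≡k (≡-mod-%ℕ x d)

toℕ-mod-≡-mod : ∀ n d .{{_ : NonZero d}} → + toℕ (n mod d) ≡[ d ] + n
toℕ-mod-≡-mod n d = subst (λ j → + j ≡[ d ] + n) (sym (toℕ-mod n d)) (≡-mod-sym (≡-mod-%ℕ (+ n) d))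

-- Passing from α + 1 to α lowers the numerator by s ≡ −3·s (mod 4).
≡-mod-shift : ∀ {x a} s → x ℤ.+ + s ≡[ 4 ] + a → x ≡[ 4 ] + (a + 3 * s)
≡-mod-shift {x} {a} s (congruent 4∣x+s-a) = congruent
  (subst (_ Signed.∣_) (trans (regroup x (+ a) (+ s)) (cong (ℤ._-_ x) (sym a+3s)))
    (Signed.∣m∣n⇒∣m-n 4∣x+s-a (Signed.∣n⇒∣m*n (+ s) (Signed.∣-refl {+ 4}))))
  where
  regroup : ∀ x a s → x ℤ.+ s ℤ.- a ℤ.- s ℤ.* + 4 ≡ x ℤ.- (a ℤ.+ + 3 ℤ.* s)
  regroup = solve-∀
  a+3s : + (a + 3 * s) ≡ + a ℤ.+ + 3 ℤ.* + s
  a+3s = trans (ℤP.pos-+ a (3 * s)) (cong (ℤ._+_ (+ a)) (ℤP.pos-* 3 s))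

coprime⇒¬bothEven : ∀ r s → Coprime ℤ.∣ r ∣ s → ¬ (r ≡[ 2 ] + 0 × + s ≡[ 2 ] + 0)
coprime⇒¬bothEven r s cop (r≡0 , s≡0) = ℕP.1+n≢n (cop (2∣ r≡0 , 2∣ s≡0))
  where
  2∣ : ∀ {x} → x ≡[ 2 ] + 0 → 2 ℕ∣.∣ ℤ.∣ x ∣
  2∣ {x} (congruent 2∣x-0) = Signed.∣⇒∣ᵤ (subst (_ Signed.∣_) (ℤP.+-identityʳ x) 2∣x-0)

ResidueClassified : ℤ → 𝔾 → Set
ResidueClassified x z =
  (x ≡[ 4 ] + 0 → z ≡ 𝟘) × (x ≡[ 4 ] + 2 → IsOnePlusI z) × (x ≡[ 2 ] + 1 → IsUnit4 z)

Classification : ℤ → ℤ → 𝔾 × 𝔾 → Set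
Classification r s (R , S) =
  ResidueClassified s S × ResidueClassified r R × (s ≡[ 4 ] r → R ≡ S) × (R ≡ S → s ≡[ 4 ] r)

residueClassified? : ∀ x z → Dec (ResidueClassified x z)
residueClassified? x z =
      (x ≡?[ 4 ] + 0 →-dec z ≟ 𝟘)
  ×-dec (x ≡?[ 4 ] + 2 →-dec isOnePlusI? z)
  ×-dec (x ≡?[ 2 ] + 1 →-dec isUnit4? z)

classification? : ∀ r s p → Dec (Classification r s p)
classification? r s (R , S) =
  residueClassified? s S ×-dec residueClassified? r R
    ×-dec (s ≡?[ 4 ] r →-dec R ≟ S) ×-dec (R ≟ S →-dec s ≡?[ 4 ] r)

residueClassified-cong : ∀ {x x' z} → x ≡[ 4 ] x' → ResidueClassified x z → ResidueClassified x' z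
residueClassified-cong x≡x' (at0 , at2 , atOdd) =
    at0 ∘ ≡-mod-trans x≡x'
  , at2 ∘ ≡-mod-trans x≡x'
  , atOdd ∘ ≡-mod-trans (≡-mod-4⇒2 x≡x')

classification-cong : ∀ {r r' s s' p} → r ≡[ 4 ] r' → s ≡[ 4 ] s' →
  Classification r s p → Classification r' s' p
classification-cong r≡r' s≡s' (S-classified , R-classified , s≡r⇒R≡S , R≡S⇒s≡r) =
    residueClassified-cong s≡s' S-classified
  , residueClassified-cong r≡r' R-classified
  , (λ s'≡r' → s≡r⇒R≡S (≡-mod-trans s≡s' (≡-mod-trans s'≡r' (≡-mod-sym r≡r'))))
  , (λ R≡S → ≡-mod-trans (≡-mod-sym s≡s') (≡-mod-trans (R≡S⇒s≡r R≡S) r≡r'))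

residueTable-classification : ∀ (a b k : Fin 4) →
  ¬ (+ toℕ a ≡[ 2 ] + 0 × + toℕ b ≡[ 2 ] + 0) →
  Classification (+ toℕ a) (+ toℕ b) (𝕚 ^ toℕ k · residueTable a b)
residueTable-classification = from-yes
  (all? λ (a : Fin 4) → all? λ (b : Fin 4) → all? λ (k : Fin 4) →
    ¬? (+ toℕ a ≡?[ 2 ] + 0 ×-dec + toℕ b ≡?[ 2 ] + 0)
      →-dec classification? (+ toℕ a) (+ toℕ b) (𝕚 ^ toℕ k · residueTable a b))

HasNormalForm : ℤ → ℕ → 𝔾 × 𝔾 → Set
HasNormalForm r s p = Σ[ a ∈ ℕ ] r ≡[ 4 ] + a × p ≃ normalForm a s

shift-hasNormalForm : ∀ {r s p} → HasNormalForm (r ℤ.+ + s) s p → HasNormalForm r s (shift p)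
shift-hasNormalForm {s = s} (a , r+s≡a , p≃) = a + 3 * s , ≡-mod-shift s r+s≡a , shift-normalForm a s p≃

coprime-+ : ∀ r s → Coprime ℤ.∣ r ∣ s → Coprime ℤ.∣ r ℤ.+ + s ∣ s
coprime-+ r s cop {d} (d∣r+s , d∣s) = cop (Signed.∣⇒∣ᵤ {+ d} {r} d∣r , d∣s)
  where
  d∣r : + d Signed.∣ r
  d∣r = Signed.∣m+n∣n⇒∣m (Signed.∣ᵤ⇒∣ {+ d} {r ℤ.+ + s} d∣r+s) (Signed.∣ᵤ⇒∣ {+ d} {+ s} d∣s)

-- The fuel f of qRatAtIAux (suc f) r s suffices as long as s < r + f·s.
fuel-exhausted : ∀ r s → + s ℤ.< r ℤ.+ + 0 → ¬ (r ℤ.≤ + s)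
fuel-exhausted r s s<r+0 r≤s = ℤP.≤⇒≯ r≤s (subst (+ s ℤ.<_) (ℤP.+-identityʳ r) s<r+0)

fuel-shift : ∀ r s f → + s ℤ.< r ℤ.+ + (suc f * s) → + s ℤ.< (r ℤ.+ + s) ℤ.+ + (f * s)
fuel-shift r s f = subst (+ s ℤ.<_) (begin
  r ℤ.+ + (s + f * s)          ≡⟨ cong (ℤ._+_ r) (ℤP.pos-+ s (f * s)) ⟩
  r ℤ.+ (+ s ℤ.+ + (f * s))    ≡⟨ ℤP.+-assoc r (+ s) (+ (f * s)) ⟨
  r ℤ.+ + s ℤ.+ + (f * s)      ∎)
  where open ≡-Reasoning

0≤m+∣m∣*n : ∀ m n → 0 < n → + 0 ℤ.≤ m ℤ.+ + (ℤ.∣ m ∣ * n)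
0≤m+∣m∣*n (+ m)    n       _ = ℤ.+≤+ ℕ.z≤n
0≤m+∣m∣*n -[1+ m ] (suc n) _ =
  subst (+ 0 ℤ.≤_) (sym (ℤP.⊖-≥ (ℕP.m≤m*n (suc m) (suc n)))) (ℤ.+≤+ ℕ.z≤n)

fuel-initial : ∀ r s → 0 < s → + s ℤ.< r ℤ.+ + ((2 + ℤ.∣ r ∣) * s)
fuel-initial r s 0<s = begin-strict
  + s                                ≡⟨ ℤP.+-identityʳ (+ s) ⟨
  + s ℤ.+ + 0                        <⟨ ℤP.+-monoʳ-< (+ s) (ℤP.+-mono-<-≤ (ℤ.+<+ 0<s) (0≤m+∣m∣*n r s 0<s)) ⟩
  + s ℤ.+ (+ s ℤ.+ (r ℤ.+ + t))      ≡⟨ regroup (+ s) r (+ t) ⟩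
  r ℤ.+ (+ s ℤ.+ (+ s ℤ.+ + t))      ≡⟨ cong (ℤ._+_ r) (trans (cong (ℤ._+_ (+ s)) (ℤP.pos-+ s t)) (ℤP.pos-+ s (s + t))) ⟨
  r ℤ.+ + ((2 + ℤ.∣ r ∣) * s)        ∎
  where
  open ℤP.≤-Reasoning
  t : ℕ
  t = ℤ.∣ r ∣ * s
  regroup : ∀ s r t → s ℤ.+ (s ℤ.+ (r ℤ.+ t)) ≡ r ℤ.+ (s ℤ.+ (s ℤ.+ t))
  regroup = solve-∀

mutual
  qRatAtIAux-normalForm : ∀ f r s → 0 < s → Coprime ℤ.∣ r ∣ s → + s ℤ.< r ℤ.+ + (f * s) →
    HasNormalForm r s (qRatAtIAux (suc f) r s)
  qRatAtIAux-normalForm f (+ n) s 0<s cop fuel with s <? n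
  ... | yes s<n = n , ≡-mod-refl (+ n) , qRatPosAux-normalForm (suc s) n s 0<s (ℕP.n<1+n s) cop
  ... | no  s≮n = shifted-normalForm f (+ n) s 0<s cop fuel (ℤ.+≤+ (ℕP.≮⇒≥ s≮n))
  qRatAtIAux-normalForm f -[1+ n ] s 0<s cop fuel = shifted-normalForm f -[1+ n ] s 0<s cop fuel ℤ.-≤+

  shifted-normalForm : ∀ f r s → 0 < s → Coprime ℤ.∣ r ∣ s → + s ℤ.< r ℤ.+ + (f * s) → r ℤ.≤ + s →
    HasNormalForm r s (shift (qRatAtIAux f (r ℤ.+ + s) s))
  shifted-normalForm zero    r s _   _   fuel r≤s = ⊥-elim (fuel-exhausted r s fuel r≤s)
  shifted-normalForm (suc f) r s 0<s cop fuel _   = shift-hasNormalForm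
    (qRatAtIAux-normalForm f (r ℤ.+ + s) s 0<s (coprime-+ r s cop) (fuel-shift r s f fuel))

qRatAtI-normalForm : ∀ r s → 0 < s → Coprime ℤ.∣ r ∣ s → HasNormalForm r s (qRatAtI r s)
qRatAtI-normalForm r s 0<s cop =
  subst (λ f → HasNormalForm r s (qRatAtIAux f r s)) (ℕP.+-comm 3 ℤ.∣ r ∣)
    (qRatAtIAux-normalForm (2 + ℤ.∣ r ∣) r s 0<s cop (fuel-initial r s 0<s))

hasNormalForm⇒classification : ∀ {r s p} → Coprime ℤ.∣ r ∣ s →
  HasNormalForm r s p → Classification r (+ s) p
hasNormalForm⇒classification {r} {s} cop (a , r≡a , k , refl) =
  classification-cong ā≡r s̄≡s
    (residueTable-classification (a mod 4) (s mod 4) k λ (ā≡0 , s̄≡0) →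
      coprime⇒¬bothEven r s cop
        ( ≡-mod-trans (≡-mod-4⇒2 (≡-mod-sym ā≡r)) ā≡0
        , ≡-mod-trans (≡-mod-4⇒2 (≡-mod-sym s̄≡s)) s̄≡0))
  where
  ā≡r : + toℕ (a mod 4) ≡[ 4 ] r
  ā≡r = ≡-mod-trans (toℕ-mod-≡-mod a 4) (≡-mod-sym r≡a)
  s̄≡s : + toℕ (s mod 4) ≡[ 4 ] + s
  s̄≡s = toℕ-mod-≡-mod s 4

corollary7p7 : (r : ℤ) (s : ℕ) → 0 < s → Coprime ℤ.∣ r ∣ s →
    ((s % 4 ≡ 0 → 𝒮[ r / s ]⟨i⟩ ≡ 𝟘)
      × (s % 4 ≡ 2 → IsOnePlusI 𝒮[ r / s ]⟨i⟩)
      × (s % 2 ≡ 1 → IsUnit4 𝒮[ r / s ]⟨i⟩)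
      × (r %ℕ 4 ≡ 0 → ℛ[ r / s ]⟨i⟩ ≡ 𝟘)
      × (r %ℕ 4 ≡ 2 → IsOnePlusI ℛ[ r / s ]⟨i⟩)
      × (r %ℕ 2 ≡ 1 → IsUnit4 ℛ[ r / s ]⟨i⟩))
    × ((+ 4 ∣ (+ s ℤ.- r)) ⇔ (ℛ[ r / s ]⟨i⟩ ≡ 𝒮[ r / s ]⟨i⟩))
corollary7p7 r s 0<s cop
  with hasNormalForm⇒classification cop (qRatAtI-normalForm r s 0<s cop)
... | (S-at0 , S-at2 , S-atOdd) , (R-at0 , R-at2 , R-atOdd) , s≡r⇒R≡S , R≡S⇒s≡r =
    ( S-at0   ∘ %ℕ⇒≡-mod (+ s) 4 0
    , S-at2   ∘ %ℕ⇒≡-mod (+ s) 4 2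
    , S-atOdd ∘ %ℕ⇒≡-mod (+ s) 2 1
    , R-at0   ∘ %ℕ⇒≡-mod r 4 0
    , R-at2   ∘ %ℕ⇒≡-mod r 4 2
    , R-atOdd ∘ %ℕ⇒≡-mod r 2 1 )
  , mk⇔ (s≡r⇒R≡S ∘ congruent ∘ Signed.∣ᵤ⇒∣ {+ 4} {+ s ℤ.- r})
        (Signed.∣⇒∣ᵤ ∘ _≡[_]_.divides ∘ R≡S⇒s≡r)
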